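{- Let $x,y$ be distinct odd primes. If $\left(\frac{x}{y}\right)=-1$, then $x$ is balanced modulo $y$.
   Context: For coprime positive integers $n,m$, "$n$ is balanced modulo $m$" is the notion of Pomerance and Ulmer; it is characterized as follows (Pomerance–Ulmer, Theorem 2.1): $n$ is NOT balanced modulo $m$ if and only if there exists an odd Dirichlet character $\chi$ modulo $m$ (i.e. $\chi(-1)=-1$) with $\chi(n)=1$ and $\sum_{0<k<m/2}\chi(k)\neq0$. $\left(\frac{x}{y}\right)$ is the Legendre symbol. -}

module Defs where

open import Data.Nat using (ℕ; _+_; _*_; _^_; _<_; _<?_; ∣_-_∣)
open import Data.Nat.Divisibility using (_∣_; _∣?_)
open import Data.Nat.Coprimality using (Coprime)
open import Data.Integer using (ℤ; +_; -[1+_])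
open import Data.List using (List; upTo; filter; length)
open import Data.List.Relation.Unary.Any using (Any; any?)
open import Data.Product using (_×_)
open import Relation.Nullary using (Dec; yes; no; ¬_)
open import Relation.Nullary.Decidable using (_×-dec_)
open import Relation.Binary.PropositionalEquality using (_≡_)

_≡_[mod_] : ℕ → ℕ → ℕ → Set
a ≡ b [mod m ] = m ∣ ∣ a - b ∣

-- r lies in the coset a·⟨n⟩ of (ℤ/mℤ)^*, i.e. r ≡ a·n^k (mod m) for some k.
-- (Exponents k < m suffice: the order of n modulo m is ≤ φ(m) < m.)
InCoset : ℕ → ℕ → ℕ → ℕ → Set
InCoset n m a r = Any (λ k → (a * n ^ k) ≡ r [mod m ]) (upTo m)

inCoset? : ∀ n m a r → Dec (InCoset n m a r)
inCoset? n m a r = any? (λ k → m ∣? ∣ a * n ^ k - r ∣) (upTo m)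

lowerCount : ℕ → ℕ → ℕ → ℕ
lowerCount n m a =
  length (filter (λ r → (0 <? r) ×-dec ((2 * r <? m) ×-dec inCoset? n m a r)) (upTo m))

upperCount : ℕ → ℕ → ℕ → ℕ
upperCount n m a =
  length (filter (λ r → (m <? 2 * r) ×-dec inCoset? n m a r) (upTo m))

Balanced : ℕ → ℕ → Set
Balanced n m = ∀ a → Coprime a m → lowerCount n m a ≡ upperCount n m a

QRes : ℕ → ℕ → Set
QRes x p = Any (λ z → (z * z) ≡ x [mod p ]) (upTo p)

qres? : ∀ x p → Dec (QRes x p)
qres? x p = any? (λ z → p ∣? ∣ z * z - x ∣) (upTo p)

legendre : ℕ → ℕ → ℤ
legendre x p with p ∣? x
... | yes _ = + 0
... | no _ with qres? x p
...   | yes _ = + 1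
...   | no _ = -[1+ 0 ]

-- Pairing every unit z with the
-- solution w of z·w ≡ x (never z itself, as x is a non-residue) gives (y−1)! ≡ x^((y−1)/2),
-- while pairing every unit other than ±1 with its inverse gives Wilson's (y−1)! ≡ −1. So −1 is
-- a power of x, every coset a⟨x⟩ is closed under r ↦ y − r, and this reflection exchanges the
-- residues of a⟨x⟩ in (0, y/2) with those in (y/2, y).

module Submission where

open import Defs
open import Algebra.Bundles using (CommutativeMonoid)
open import Algebra.Structures using (IsCommutativeMonoid)
import Algebra.Definitions.RawMonoid as RawMonoidDefinitions
import Algebra.Properties.CommutativeSemigroup as CommutativeSemigroupProperties
open import Data.Nat as ℕ using (ℕ; zero; suc; _<_; _≤_; _∸_; _<?_; NonZero; z≤n; s≤s)
import Data.Nat.Properties as ℕ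
open import Data.Nat.Divisibility using (_∣_; _∣?_; ∣-refl; >⇒∤)
open import Data.Nat.Coprimality using (prime⇒coprime; coprime-Bézout)
open import Data.Nat.GCD using (module Bézout)
open import Data.Nat.Primality using (Prime; euclidsLemma; prime⇒nonZero; prime⇒nonTrivial; ¬prime[0]; ¬prime[1])
open import Data.Integer as ℤ using (ℤ; +_; -[1+_]; -_; _+_; _-_; _*_; _^_; _⊖_; 1ℤ; -1ℤ; _%ℕ_; _/ℕ_)
import Data.Integer.Properties as ℤ
open import Data.Integer.DivMod using (n%ℕd<d; a≡a%ℕn+[a/ℕn]*n)
import Data.Integer.Divisibility.Signed as ℤ
open import Data.Integer.Tactic.RingSolver using (solve-∀)
open import Data.List using ([]; _∷_; map; filter; length; upTo; applyUpTo; applyDownFrom; reverse)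
open import Data.List.Properties using (map-upTo; reverse-upTo)
open import Data.List.Relation.Unary.All as All using (All; []; _∷_)
open import Data.List.Membership.Propositional using (find; lose)
open import Data.List.Membership.Propositional.Properties using (∈-upTo⁺; ∈-upTo⁻)
open import Data.List.Relation.Binary.Permutation.Propositional.Properties using (↭-length; filter-↭; ↭-reverse)
open import Data.Product using (_×_; _,_; ∃-syntax; proj₁; proj₂)
open import Data.Sum using (_⊎_; inj₁; inj₂)
open import Function using (_∘_; const; _⇔_; mk⇔; Equivalence)
open import Function.Construct.Composition using (_⇔-∘_)
open import Function.Construct.Symmetry using (⇔-sym)
open import Level using (Level; 0ℓ)
open import Relation.Binary.Bundles using (Setoid)
open import Relation.Binary.Structures using (IsEquivalence)
open import Relation.Binary.PropositionalEquality as ≡ using (_≡_; _≢_; refl; sym; trans; cong; subst)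
import Relation.Binary.Reasoning.Setoid as ≈-Reasoning
open import Relation.Nullary using (Dec; ¬_; yes; no; ¬?; contradiction)
open import Relation.Nullary.Decidable using (_×-dec_)
open import Relation.Unary using (Pred; Decidable)

private variable
  a p q s : Level
  A : Set a
  P : Pred ℕ p
  Q : Pred ℕ q
  S : Pred ℕ s

-- Counting under the reflection r ↦ m − r

applyDownFrom≡applyUpTo : ∀ (f : ℕ → A) n → applyDownFrom f n ≡ applyUpTo (λ r → f (n ∸ suc r)) n
applyDownFrom≡applyUpTo f zero = refl
applyDownFrom≡applyUpTo f (suc n) = cong (f n ∷_) (applyDownFrom≡applyUpTo f n)

module _ {P : Pred A p} (P? : Decidable P) where

  length-filter-map : ∀ {b} {B : Set b} (f : B → A) xs →
                      length (filter P? (map f xs)) ≡ length (filter (P? ∘ f) xs)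
  length-filter-map f [] = refl
  length-filter-map f (x ∷ xs) with P? (f x)
  ... | yes _ = cong suc (length-filter-map f xs)
  ... | no _ = length-filter-map f xs

  length-filter-cong : ∀ {Q : Pred A q} (Q? : Decidable Q) {xs} →
                       All (λ x → P x ⇔ Q x) xs → length (filter P? xs) ≡ length (filter Q? xs)
  length-filter-cong Q? [] = refl
  length-filter-cong Q? {x ∷ _} (P⇔Q ∷ eqs) with P? x | Q? x
  ... | yes _  | yes _  = cong suc (length-filter-cong Q? eqs)
  ... | no _   | no _   = length-filter-cong Q? eqs
  ... | yes Px | no ¬Qx = contradiction (Equivalence.to P⇔Q Px) ¬Qx
  ... | no ¬Px | yes Qx = contradiction (Equivalence.from P⇔Q Qx) ¬Px

count : Decidable P → ℕ → ℕ
count P? n = length (filter P? (upTo n))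

count-cong : (P? : Decidable P) (Q? : Decidable Q) {n : ℕ} →
             (∀ {r} → r < n → P r ⇔ Q r) → count P? n ≡ count Q? n
count-cong P? Q? P⇔Q = length-filter-cong P? Q? (All.tabulate (P⇔Q ∘ ∈-upTo⁻))

count-suc : (P? : Decidable P) {n : ℕ} → ¬ P 0 → count P? (suc n) ≡ count (P? ∘ suc) n
count-suc P? {n} ¬P0 with P? 0
... | yes P0 = contradiction P0 ¬P0
... | no _ = trans (cong (length ∘ filter P?) (sym (map-upTo suc n))) (length-filter-map P? suc (upTo n))

count-reverse : (P? : Decidable P) (n : ℕ) → count P? n ≡ count (P? ∘ λ r → n ∸ suc r) n
count-reverse P? n = begin
  length (filter P? (upTo n))
    ≡⟨ ↭-length (filter-↭ P? (↭-reverse (upTo n))) ⟨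
  length (filter P? (reverse (upTo n)))
    ≡⟨ cong (length ∘ filter P?) (trans (reverse-upTo n) (applyDownFrom≡applyUpTo _ n)) ⟩
  length (filter P? (applyUpTo (λ r → n ∸ suc r) n))
    ≡⟨ cong (length ∘ filter P?) (map-upTo _ n) ⟨
  length (filter P? (map (λ r → n ∸ suc r) (upTo n)))
    ≡⟨ length-filter-map P? _ (upTo n) ⟩
  count (P? ∘ λ r → n ∸ suc r) n
    ∎
  where open ≡.≡-Reasoning

count-reflection : (P? : Decidable P) (Q? : Decidable Q) {m : ℕ} → ¬ P 0 → ¬ Q 0 →
                   (∀ {r s} → r ℕ.+ s ≡ m → 0 < r → 0 < s → P r ⇔ Q s) →
                   count P? m ≡ count Q? m
count-reflection P? Q? {zero} _ _ _ = refl
count-reflection P? Q? {suc n} ¬P0 ¬Q0 P⇔Q = begin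
  count P? (suc n)                     ≡⟨ count-suc P? ¬P0 ⟩
  count (P? ∘ suc) n                   ≡⟨ count-reverse (P? ∘ suc) n ⟩
  count (P? ∘ suc ∘ λ r → n ∸ suc r) n ≡⟨ count-cong _ _ (λ r<n → P⇔Q (reflected r<n) ℕ.z<s ℕ.z<s) ⟩
  count (Q? ∘ suc) n                   ≡⟨ count-suc Q? ¬Q0 ⟨
  count Q? (suc n)                     ∎
  where
  open ≡.≡-Reasoning
  reflected : ∀ {r} → r < n → suc (n ∸ suc r) ℕ.+ suc r ≡ suc n
  reflected r<n = cong suc (ℕ.m∸n+n≡m r<n)

-- Products over finite sets in a commutative monoid; the pairing argument

infixl 5 _∖_ _∖?_

_∖_ : Pred ℕ s → ℕ → Pred ℕ s
(S ∖ m) z = S z × z ≢ m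

_∖?_ : Decidable S → (m : ℕ) → Decidable (S ∖ m)
(S? ∖? m) z = S? z ×-dec ¬? (z ℕ.≟ m)

module FiniteProduct {c ℓ} (M : CommutativeMonoid c ℓ) (f : ℕ → CommutativeMonoid.Carrier M) where

  open CommutativeMonoid M hiding (sym) renaming (refl to ≈-refl; trans to ≈-trans)
  open CommutativeSemigroupProperties commutativeSemigroup using (x∙yz≈y∙xz)

  ∏ : Decidable S → ℕ → Carrier
  ∏ S? zero = ε
  ∏ S? (suc n) with S? n
  ... | yes _ = f n ∙ ∏ S? n
  ... | no _  = ∏ S? n

  ∏-∈ : (S? : Decidable S) {n : ℕ} → S n → ∏ S? (suc n) ≡ f n ∙ ∏ S? n
  ∏-∈ S? {n} n∈S with S? n
  ... | yes _   = refl
  ... | no n∉S = contradiction n∈S n∉S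

  ∏-∉ : (S? : Decidable S) {n : ℕ} → ¬ S n → ∏ S? (suc n) ≡ ∏ S? n
  ∏-∉ S? {n} n∉S with S? n
  ... | yes n∈S = contradiction n∈S n∉S
  ... | no _    = refl

  ∏-∖-≥ : (S? : Decidable S) {m n : ℕ} → n ≤ m → ∏ (S? ∖? m) n ≡ ∏ S? n
  ∏-∖-≥ S? {n = zero} _ = refl
  ∏-∖-≥ {S = S} S? {m} {suc n} n<m = step (S? n)
    where
    open ≡.≡-Reasoning
    step : Dec (S n) → ∏ (S? ∖? m) (suc n) ≡ ∏ S? (suc n)
    step (yes n∈S) = begin
      ∏ (S? ∖? m) (suc n)  ≡⟨ ∏-∈ (S? ∖? m) (n∈S , ℕ.<⇒≢ n<m) ⟩
      f n ∙ ∏ (S? ∖? m) n  ≡⟨ cong (f n ∙_) (∏-∖-≥ S? (ℕ.<⇒≤ n<m)) ⟩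
      f n ∙ ∏ S? n         ≡⟨ ∏-∈ S? n∈S ⟨
      ∏ S? (suc n)         ∎
    step (no n∉S) = begin
      ∏ (S? ∖? m) (suc n)  ≡⟨ ∏-∉ (S? ∖? m) (λ (n∈S , _) → n∉S n∈S) ⟩
      ∏ (S? ∖? m) n        ≡⟨ ∏-∖-≥ S? (ℕ.<⇒≤ n<m) ⟩
      ∏ S? n               ≡⟨ ∏-∉ S? n∉S ⟨
      ∏ S? (suc n)         ∎

  ∏-remove : (S? : Decidable S) {m n : ℕ} → m < n → S m → ∏ S? n ≈ f m ∙ ∏ (S? ∖? m) n
  ∏-remove {S = S} S? {m} {suc n} m<1+n m∈S with ℕ.m<1+n⇒m<n∨m≡n m<1+n
  ... | inj₂ refl = begin
    ∏ S? (suc m)               ≡⟨ ∏-∈ S? m∈S ⟩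
    f m ∙ ∏ S? m               ≡⟨ cong (f m ∙_) (∏-∖-≥ S? {m} ℕ.≤-refl) ⟨
    f m ∙ ∏ (S? ∖? m) m        ≡⟨ cong (f m ∙_) (∏-∉ (S? ∖? m) (λ (_ , m≢m) → m≢m refl)) ⟨
    f m ∙ ∏ (S? ∖? m) (suc m)  ∎
    where open ≈-Reasoning setoid
  ... | inj₁ m<n = step (S? n)
    where
    open ≈-Reasoning setoid
    step : Dec (S n) → ∏ S? (suc n) ≈ f m ∙ ∏ (S? ∖? m) (suc n)
    step (yes n∈S) = begin
      ∏ S? (suc n)                 ≡⟨ ∏-∈ S? n∈S ⟩
      f n ∙ ∏ S? n                 ≈⟨ ∙-congˡ (∏-remove S? m<n m∈S) ⟩
      f n ∙ (f m ∙ ∏ (S? ∖? m) n)  ≈⟨ x∙yz≈y∙xz (f n) (f m) _ ⟩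
      f m ∙ (f n ∙ ∏ (S? ∖? m) n)  ≡⟨ cong (f m ∙_) (∏-∈ (S? ∖? m) (n∈S , ℕ.>⇒≢ m<n)) ⟨
      f m ∙ ∏ (S? ∖? m) (suc n)    ∎
    step (no n∉S) = begin
      ∏ S? (suc n)                 ≡⟨ ∏-∉ S? n∉S ⟩
      ∏ S? n                       ≈⟨ ∏-remove S? m<n m∈S ⟩
      f m ∙ ∏ (S? ∖? m) n          ≡⟨ cong (f m ∙_) (∏-∉ (S? ∖? m) (λ (n∈S , _) → n∉S n∈S)) ⟨
      f m ∙ ∏ (S? ∖? m) (suc n)    ∎

module Size = FiniteProduct ℕ.+-0-commutativeMonoid (const 1)

size : Decidable S → ℕ → ℕ
size = Size.∏

size-≤ : (S? : Decidable S) (n : ℕ) → size S? n ≤ n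
size-≤ S? zero = z≤n
size-≤ S? (suc n) with S? n
... | yes _ = s≤s (size-≤ S? n)
... | no _  = ℕ.m≤n⇒m≤1+n (size-≤ S? n)

module Pairing {c ℓ} (M : CommutativeMonoid c ℓ) (f : ℕ → CommutativeMonoid.Carrier M)
               (k : CommutativeMonoid.Carrier M) where

  open CommutativeMonoid M hiding (sym) renaming (refl to ≈-refl; trans to ≈-trans)
  open FiniteProduct M f

  _^ᴹ_ : Carrier → ℕ → Carrier
  x ^ᴹ e = RawMonoidDefinitions._×_ rawMonoid e x

  Partners : ℕ → ℕ → Set ℓ
  Partners z w = f z ∙ f w ≈ k

  partners-sym : ∀ {z w} → Partners z w → Partners w z
  partners-sym z~w = ≈-trans (comm _ _) z~w

  Matched : Pred ℕ s → Set _
  Matched S = ∀ {z} → S z → ∃[ w ] S w × w ≢ z × Partners z w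

  PartnersUnique : Pred ℕ s → Set _
  PartnersUnique S = ∀ {z w w′} → S z → S w → S w′ → Partners z w → Partners z w′ → w ≡ w′

  module _ {S : Pred ℕ s} (unique : PartnersUnique S) {m n : ℕ} (m∈S : S m) (n∈S : S n) (m~n : Partners m n) where

    ∖-pair-unique : PartnersUnique (S ∖ m ∖ n)
    ∖-pair-unique ((z∈S , _) , _) ((w∈S , _) , _) ((w′∈S , _) , _) = unique z∈S w∈S w′∈S

    ∖-pair-matched : Matched S → Matched (S ∖ m ∖ n)
    ∖-pair-matched matched ((z∈S , z≢m) , z≢n) with matched z∈S
    ... | w , w∈S , w≢z , z~w = w , ((w∈S , w≢m) , w≢n) , w≢z , z~w
      where
      w≢m : w ≢ m
      w≢m refl = z≢n (unique m∈S z∈S n∈S (partners-sym z~w) m~n)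
      w≢n : w ≢ n
      w≢n refl = z≢m (unique n∈S z∈S m∈S (partners-sym z~w) (partners-sym m~n))

  pairing : (n : ℕ) {S : Pred ℕ s} (S? : Decidable S) → (∀ {z} → S z → z < n) →
            Matched S → PartnersUnique S →
            ∃[ e ] e ℕ.+ e ≡ size S? n × ∏ S? n ≈ k ^ᴹ e
  pairing zero S? _ _ _ = 0 , refl , ≈-refl
  pairing (suc n) {S} S? bounded matched unique with S? n
  ... | no n∉S = pairing n S? bounded′ matched unique
    where
    bounded′ : ∀ {z} → S z → z < n
    bounded′ {z} z∈S = ℕ.≤∧≢⇒< (ℕ.≤-pred (bounded z∈S)) λ { refl → n∉S z∈S }
  ... | yes n∈S with matched n∈S
  ...   | m , m∈S , m≢n , n~m
    with pairing n (S? ∖? m ∖? n) bounded′ (∖-pair-matched unique m∈S n∈S m~n matched)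
                                            (∖-pair-unique unique m∈S n∈S m~n)
    where
    m~n = partners-sym n~m
    bounded′ : ∀ {z} → (S ∖ m ∖ n) z → z < n
    bounded′ {z} ((z∈S , _) , z≢n) = ℕ.≤∧≢⇒< (ℕ.≤-pred (bounded z∈S)) z≢n
  ...     | e , e+e≡size , ∏≈k^e = suc e , size-eq , ∏-eq
    where
    m<n : m < n
    m<n = ℕ.≤∧≢⇒< (ℕ.≤-pred (bounded m∈S)) m≢n
    size-eq : suc e ℕ.+ suc e ≡ suc (size S? n)
    size-eq = begin
      suc e ℕ.+ suc e                    ≡⟨ cong suc (ℕ.+-suc e e) ⟩
      suc (suc (e ℕ.+ e))                ≡⟨ cong (suc ∘ suc) e+e≡size ⟩
      suc (suc (size (S? ∖? m ∖? n) n))  ≡⟨ cong (suc ∘ suc) (Size.∏-∖-≥ (S? ∖? m) {n} ℕ.≤-refl) ⟩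
      suc (suc (size (S? ∖? m) n))       ≡⟨ cong suc (Size.∏-remove S? m<n m∈S) ⟨
      suc (size S? n)                    ∎
      where open ≡.≡-Reasoning
    ∏-eq : f n ∙ ∏ S? n ≈ k ^ᴹ suc e
    ∏-eq = begin
      f n ∙ ∏ S? n                      ≈⟨ ∙-congˡ (∏-remove S? m<n m∈S) ⟩
      f n ∙ (f m ∙ ∏ (S? ∖? m) n)       ≈⟨ assoc _ _ _ ⟨
      (f n ∙ f m) ∙ ∏ (S? ∖? m) n       ≡⟨ cong ((f n ∙ f m) ∙_) (∏-∖-≥ (S? ∖? m) {n} ℕ.≤-refl) ⟨
      (f n ∙ f m) ∙ ∏ (S? ∖? m ∖? n) n  ≈⟨ ∙-cong n~m ∏≈k^e ⟩
      k ∙ k ^ᴹ e                        ∎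
      where open ≈-Reasoning setoid

∣m⊖n∣≡∣m-n∣ : ∀ m n → ℤ.∣ m ⊖ n ∣ ≡ ℕ.∣ m - n ∣
∣m⊖n∣≡∣m-n∣ zero    zero    = refl
∣m⊖n∣≡∣m-n∣ zero    (suc n) = refl
∣m⊖n∣≡∣m-n∣ (suc m) zero    = refl
∣m⊖n∣≡∣m-n∣ (suc m) (suc n) = trans (cong ℤ.∣_∣ (ℤ.[1+m]⊖[1+n]≡m⊖n m n)) (∣m⊖n∣≡∣m-n∣ m n)

∣[+m]-[+n]∣≡∣m-n∣ : ∀ m n → ℤ.∣ + m - + n ∣ ≡ ℕ.∣ m - n ∣
∣[+m]-[+n]∣≡∣m-n∣ m n = trans (cong ℤ.∣_∣ (ℤ.[+m]-[+n]≡m⊖n m n)) (∣m⊖n∣≡∣m-n∣ m n)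

multiple<⇒≡0 : ∀ {m n} → m ∣ n → n < m → n ≡ 0
multiple<⇒≡0 {n = zero}  _   _   = refl
multiple<⇒≡0 {n = suc n} m∣n n<m = contradiction m∣n (>⇒∤ n<m)

pos-^ : ∀ a n → + (a ℕ.^ n) ≡ (+ a) ^ n
pos-^ a zero    = refl
pos-^ a (suc n) = trans (ℤ.pos-* a (a ℕ.^ n)) (cong (+ a *_) (pos-^ a n))

module IntegerCongruence (m : ℕ) where

  infix 4 _≈_
  -- A record rather than an alias of divisibility, so that u and v are inferable from a proof.
  record _≈_ (u v : ℤ) : Set where
    constructor divides-difference
    field m∣difference : + m ℤ.∣ u - v
  open _≈_

  ≈-via : ∀ {u v w} → u - v ≡ w → + m ℤ.∣ w → u ≈ v
  ≈-via refl m∣w = divides-difference m∣w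

  private
    diff-sym : ∀ u v → v - u ≡ - (u - v)
    diff-sym = solve-∀
    diff-trans : ∀ u v w → u - w ≡ (u - v) + (v - w)
    diff-trans = solve-∀
    diff-* : ∀ u u′ v v′ → u * v - u′ * v′ ≡ (u - u′) * v + u′ * (v - v′)
    diff-* = solve-∀
    diff-neg : ∀ u v → - u - - v ≡ - (u - v)
    diff-neg = solve-∀

  ≈-reflexive : ∀ {u v} → u ≡ v → u ≈ v
  ≈-reflexive {u} refl = ≈-via (ℤ.+-inverseʳ u) (ℤ.divides ℤ.0ℤ refl)

  ≈-refl : ∀ {u} → u ≈ u
  ≈-refl = ≈-reflexive refl

  ≈-sym : ∀ {u v} → u ≈ v → v ≈ u
  ≈-sym {u} {v} u≈v = ≈-via (diff-sym u v) (ℤ.∣m⇒∣-m (m∣difference u≈v))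

  ≈-trans : ∀ {u v w} → u ≈ v → v ≈ w → u ≈ w
  ≈-trans {u} {v} {w} u≈v v≈w =
    ≈-via (diff-trans u v w) (ℤ.∣m∣n⇒∣m+n (m∣difference u≈v) (m∣difference v≈w))

  ≈-isEquivalence : IsEquivalence _≈_
  ≈-isEquivalence = record { refl = ≈-refl ; sym = ≈-sym ; trans = ≈-trans }

  ≈-setoid : Setoid _ _
  ≈-setoid = record { isEquivalence = ≈-isEquivalence }

  *-cong : ∀ {u u′ v v′} → u ≈ u′ → v ≈ v′ → u * v ≈ u′ * v′
  *-cong {u} {u′} {v} {v′} u≈u′ v≈v′ =
    ≈-via (diff-* u u′ v v′)
          (ℤ.∣m∣n⇒∣m+n (ℤ.∣m⇒∣m*n v (m∣difference u≈u′)) (ℤ.∣n⇒∣m*n u′ (m∣difference v≈v′)))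

  -‿cong : ∀ {u v} → u ≈ v → - u ≈ - v
  -‿cong {u} {v} u≈v = ≈-via (diff-neg u v) (ℤ.∣m⇒∣-m (m∣difference u≈v))

  *-1-isCommutativeMonoid : IsCommutativeMonoid _≈_ _*_ 1ℤ
  *-1-isCommutativeMonoid = record
    { isMonoid = record
      { isSemigroup = record
        { isMagma = record { isEquivalence = ≈-isEquivalence ; ∙-cong = *-cong }
        ; assoc = λ u v w → ≈-reflexive (ℤ.*-assoc u v w)
        }
      ; identity = (λ u → ≈-reflexive (ℤ.*-identityˡ u)) , (λ u → ≈-reflexive (ℤ.*-identityʳ u))
      }
    ; comm = λ u v → ≈-reflexive (ℤ.*-comm u v)
    }

  *-1-commutativeMonoid : CommutativeMonoid _ _
  *-1-commutativeMonoid = record { isCommutativeMonoid = *-1-isCommutativeMonoid }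

  ×≡^ : ∀ e u → RawMonoidDefinitions._×_ (CommutativeMonoid.rawMonoid *-1-commutativeMonoid) e u ≡ u ^ e
  ×≡^ zero    u = refl
  ×≡^ (suc e) u = cong (u *_) (×≡^ e u)

  ≡[mod]⇒≈ : ∀ {a b} → a ≡ b [mod m ] → + a ≈ + b
  ≡[mod]⇒≈ {a} {b} m∣∣a-b∣ =
    divides-difference (ℤ.∣ᵤ⇒∣ (subst (m ∣_) (sym (∣[+m]-[+n]∣≡∣m-n∣ a b)) m∣∣a-b∣))

  ≈⇒≡[mod] : ∀ {a b} → + a ≈ + b → a ≡ b [mod m ]
  ≈⇒≡[mod] {a} {b} a≈b = subst (m ∣_) (∣[+m]-[+n]∣≡∣m-n∣ a b) (ℤ.∣⇒∣ᵤ (m∣difference a≈b))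

  residue-unique : ∀ {a b} → a < m → b < m → + a ≈ + b → a ≡ b
  residue-unique {a} {b} a<m b<m a≈b = ℕ.∣m-n∣≡0⇒m≡n (multiple<⇒≡0 (≈⇒≡[mod] a≈b) ∣a-b∣<m)
    where
    ∣a-b∣<m : ℕ.∣ a - b ∣ < m
    ∣a-b∣<m = ℕ.≤-<-trans (ℕ.∣m-n∣≤m⊔n a b) (ℕ.⊔-lub a<m b<m)

  complement≈- : ∀ {r s} → r ℕ.+ s ≡ m → + s ≈ - + r
  complement≈- {r} {s} r+s≡m = ≈-via eq (ℤ.divides 1ℤ (sym (ℤ.*-identityˡ (+ m))))
    where
    rearrange : ∀ r s → s - - r ≡ r + s
    rearrange = solve-∀
    eq : + s - - + r ≡ + m
    eq = trans (rearrange (+ r) (+ s)) (trans (sym (ℤ.pos-+ r s)) (cong +_ r+s≡m))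

-- Units modulo a prime: Wilson's theorem and Euler's criterion

module PrimeModulus {p : ℕ} (p-prime : Prime p) where

  open IntegerCongruence p
  open FiniteProduct *-1-commutativeMonoid +_ using (∏; ∏-remove)

  private instance
    p≢0 : NonZero p
    p≢0 = prime⇒nonZero p-prime

  1<p : 1 < p
  1<p = ℕ.nonTrivial⇒n>1 p {{prime⇒nonTrivial p-prime}}

  Unit : Pred ℕ 0ℓ
  Unit z = 0 < z × z < p

  unit? : Decidable Unit
  unit? z = 0 <? z ×-dec z <? p

  euclid : ∀ {u v} → + p ℤ.∣ u * v → + p ℤ.∣ u ⊎ + p ℤ.∣ v
  euclid {u} {v} p∣uv
    with euclidsLemma ℤ.∣ u ∣ ℤ.∣ v ∣ p-prime (subst (p ∣_) (ℤ.abs-* u v) (ℤ.∣⇒∣ᵤ p∣uv))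
  ... | inj₁ p∣u = inj₁ (ℤ.∣ᵤ⇒∣ p∣u)
  ... | inj₂ p∣v = inj₂ (ℤ.∣ᵤ⇒∣ p∣v)

  unit⇒∤ : ∀ {z} → Unit z → ¬ (+ p ℤ.∣ + z)
  unit⇒∤ (0<z , z<p) p∣z = >⇒∤ {{ℕ.>-nonZero 0<z}} z<p (ℤ.∣⇒∣ᵤ p∣z)

  cancelˡ : ∀ {w u v} → ¬ (+ p ℤ.∣ w) → w * u ≈ w * v → u ≈ v
  cancelˡ {w} {u} {v} p∤w wu≈wv with euclid (subst (+ p ℤ.∣_) (factor w u v) (_≈_.m∣difference wu≈wv))
    where
    factor : ∀ w u v → w * u - w * v ≡ w * (u - v)
    factor = solve-∀
  ... | inj₁ p∣w = contradiction p∣w p∤w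
  ... | inj₂ p∣u-v = divides-difference p∣u-v

  square≈1 : ∀ {u} → u * u ≈ 1ℤ → u ≈ 1ℤ ⊎ u ≈ -1ℤ
  square≈1 {u} u²≈1 with euclid (subst (+ p ℤ.∣_) (factor u) (_≈_.m∣difference u²≈1))
    where
    factor : ∀ u → u * u - 1ℤ ≡ (u - 1ℤ) * (u - -1ℤ)
    factor = solve-∀
  ... | inj₁ p∣u-1 = inj₁ (divides-difference p∣u-1)
  ... | inj₂ p∣u+1 = inj₂ (divides-difference p∣u+1)

  private
    cast-1+*≡* : ∀ b c d e → 1 ℕ.+ b ℕ.* c ≡ d ℕ.* e → 1ℤ + + b * + c ≡ + d * + e
    cast-1+*≡* b c d e eq = trans (cong (λ t → 1ℤ + t) (sym (ℤ.pos-* b c))) (trans (cong +_ eq) (ℤ.pos-* d e))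

  ∃-inverse : ∀ {z} → Unit z → ∃[ t ] + z * t ≈ 1ℤ
  ∃-inverse {z} (0<z , z<p) with coprime-Bézout (prime⇒coprime p-prime {{ℕ.>-nonZero 0<z}} z<p)
  ... | Bézout.+- a b 1+bz≡ap = - + b , ≈-via eq (ℤ.divides (- + a) refl)
    where
    rearrange : ∀ z b → z * - b - 1ℤ ≡ - (1ℤ + b * z)
    rearrange = solve-∀
    eq : + z * - + b - 1ℤ ≡ - + a * + p
    eq = trans (rearrange (+ z) (+ b)) (trans (cong -_ (cast-1+*≡* b z a p 1+bz≡ap)) (ℤ.neg-distribˡ-* (+ a) (+ p)))
  ... | Bézout.-+ a b 1+ap≡bz = + b , ≈-via eq (ℤ.divides (+ a) refl)
    where
    commute : ∀ z b → z * b - 1ℤ ≡ b * z - 1ℤ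
    commute = solve-∀
    cancel : ∀ t → 1ℤ + t - 1ℤ ≡ t
    cancel = solve-∀
    eq : + z * + b - 1ℤ ≡ + a * + p
    eq = trans (commute (+ z) (+ b)) (trans (cong (_- 1ℤ) (sym (cast-1+*≡* a p b z 1+ap≡bz))) (cancel (+ a * + p)))

  ∃-solution : ∀ {z} → Unit z → ∀ c → ∃[ w ] w < p × + z * + w ≈ + c
  ∃-solution {z} z-unit c = w , n%ℕd<d (+ c * t) p , (begin
    + z * + w          ≈⟨ *-cong (≈-refl {+ z}) w≈ct ⟩
    + z * (+ c * t)    ≡⟨ swap (+ z) (+ c) t ⟩
    + c * (+ z * t)    ≈⟨ *-cong (≈-refl {+ c}) zt≈1 ⟩
    + c * 1ℤ           ≡⟨ ℤ.*-identityʳ (+ c) ⟩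
    + c                ∎)
    where
    open ≈-Reasoning ≈-setoid
    t = proj₁ (∃-inverse z-unit)
    zt≈1 = proj₂ (∃-inverse z-unit)
    w = (+ c * t) %ℕ p
    swap : ∀ z c t → z * (c * t) ≡ c * (z * t)
    swap = solve-∀
    remainder : ∀ r q m → r - (r + q * m) ≡ - q * m
    remainder = solve-∀
    quotient = (+ c * t) /ℕ p
    w≈ct : + w ≈ + c * t
    w≈ct = ≈-via (trans (cong (λ s → + w - s) (a≡a%ℕn+[a/ℕn]*n (+ c * t) p)) (remainder (+ w) quotient (+ p)))
                 (ℤ.divides (- quotient) refl)

  solution-unique : ∀ {z w w′ c} → Unit z → w < p → w′ < p → + z * + w ≈ c → + z * + w′ ≈ c → w ≡ w′
  solution-unique z-unit w<p w′<p zw≈c zw′≈c =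
    residue-unique w<p w′<p (cancelˡ (unit⇒∤ z-unit) (≈-trans zw≈c (≈-sym zw′≈c)))

  solution-unit : ∀ {z w c} → ¬ (p ∣ c) → w < p → + z * + w ≈ + c → Unit w
  solution-unit {z} {zero} p∤c _ z0≈c =
    contradiction (≈⇒≡[mod] (≈-trans (≈-reflexive (sym (ℤ.*-zeroʳ (+ z)))) z0≈c)) p∤c
  solution-unit {w = suc _} _ w<p _ = ℕ.z<s , w<p

  p∸1<p : p ∸ 1 < p
  p∸1<p = ℕ.∸-monoʳ-< {o = 0} ℕ.z<s (ℕ.<⇒≤ 1<p)

  p∸1≈-1 : + (p ∸ 1) ≈ -1ℤ
  p∸1≈-1 = complement≈- (ℕ.m+[n∸m]≡n (ℕ.<⇒≤ 1<p))

  self-inverse⇒±1 : ∀ {z} → z < p → + z * + z ≈ 1ℤ → z ≡ 1 ⊎ z ≡ p ∸ 1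
  self-inverse⇒±1 z<p z²≈1 with square≈1 z²≈1
  ... | inj₁ z≈1  = inj₁ (residue-unique z<p 1<p z≈1)
  ... | inj₂ z≈-1 = inj₂ (residue-unique z<p p∸1<p (≈-trans z≈-1 (≈-sym p∸1≈-1)))


  units-pairing : ∀ c {s} {S : Pred ℕ s} (S? : Decidable S) → (∀ {z} → S z → Unit z) →
                  (∀ {z w} → S z → w < p → + z * + w ≈ + c → S w × w ≢ z) →
                  ∃[ e ] e ℕ.+ e ≡ size S? p × ∏ S? p ≈ (+ c) ^ e
  units-pairing c S? units closed =
    let e , e+e≡size , ∏≈cᵉ = Pairing.pairing *-1-commutativeMonoid +_ (+ c) p S? (proj₂ ∘ units) matched unique
    in e , e+e≡size , ≈-trans ∏≈cᵉ (≈-reflexive (×≡^ e (+ c)))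
    where
    matched : Pairing.Matched *-1-commutativeMonoid +_ (+ c) _
    matched z∈S =
      let w , w<p , zw≈c = ∃-solution (units z∈S) c
          w∈S , w≢z = closed z∈S w<p zw≈c
      in w , w∈S , w≢z , zw≈c
    unique : Pairing.PartnersUnique *-1-commutativeMonoid +_ (+ c) _
    unique z∈S w∈S w′∈S = solution-unique (units z∈S) (proj₂ (units w∈S)) (proj₂ (units w′∈S))

  1-unit : Unit 1
  1-unit = ℕ.z<s , 1<p

  p∸1-unit : Unit (p ∸ 1)
  p∸1-unit = ℕ.m<n⇒0<n∸m 1<p , p∸1<p

  [p∸1]²≈1 : + (p ∸ 1) * + (p ∸ 1) ≈ 1ℤ
  [p∸1]²≈1 = *-cong p∸1≈-1 p∸1≈-1

  inverse-of-self-inverse : ∀ {z v} → Unit v → z < p → + z * + v ≈ 1ℤ → + v * + v ≈ 1ℤ → z ≡ v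
  inverse-of-self-inverse {z} {v} v-unit z<p zv≈1 =
    solution-unique v-unit z<p (proj₂ v-unit) (≈-trans (≈-reflexive (ℤ.*-comm (+ v) (+ z))) zv≈1)

  wilson : 2 < p → ∏ unit? p ≈ -1ℤ
  wilson 2<p = begin
    ∏ unit? p
      ≈⟨ ∏-remove unit? p∸1<p p∸1-unit ⟩
    + (p ∸ 1) * ∏ (unit? ∖? (p ∸ 1)) p
      ≈⟨ *-cong (≈-refl {+ (p ∸ 1)}) (∏-remove (unit? ∖? (p ∸ 1)) 1<p (1-unit , 1≢p∸1)) ⟩
    + (p ∸ 1) * (1ℤ * ∏ (unit? ∖? (p ∸ 1) ∖? 1) p)
      ≈⟨ *-cong (≈-refl {+ (p ∸ 1)}) (*-cong (≈-refl {1ℤ}) ∏≈1ᵉ) ⟩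
    + (p ∸ 1) * (1ℤ * 1ℤ ^ e)
      ≡⟨ cong (+ (p ∸ 1) *_) (trans (ℤ.*-identityˡ _) (ℤ.^-zeroˡ e)) ⟩
    + (p ∸ 1) * 1ℤ
      ≡⟨ ℤ.*-identityʳ _ ⟩
    + (p ∸ 1)
      ≈⟨ p∸1≈-1 ⟩
    -1ℤ
      ∎
    where
    open ≈-Reasoning ≈-setoid
    1≢p∸1 : 1 ≢ p ∸ 1
    1≢p∸1 = ℕ.<⇒≢ (ℕ.suc[m]≤n⇒m≤pred[n] 2<p)
    closed : ∀ {z w} → (Unit ∖ (p ∸ 1) ∖ 1) z → w < p → + z * + w ≈ 1ℤ →
             (Unit ∖ (p ∸ 1) ∖ 1) w × w ≢ z
    closed {z} {w} (((_ , z<p) , z≢p∸1) , z≢1) w<p zw≈1 =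
      ((solution-unit {z} (>⇒∤ 1<p) w<p zw≈1 , w≢p∸1) , w≢1) , w≢z
      where
      w≢p∸1 : w ≢ p ∸ 1
      w≢p∸1 refl = z≢p∸1 (inverse-of-self-inverse p∸1-unit z<p zw≈1 [p∸1]²≈1)
      w≢1 : w ≢ 1
      w≢1 refl = z≢1 (inverse-of-self-inverse 1-unit z<p zw≈1 ≈-refl)
      w≢z : w ≢ z
      w≢z refl with self-inverse⇒±1 z<p zw≈1
      ... | inj₁ z≡1   = z≢1 z≡1
      ... | inj₂ z≡p∸1 = z≢p∸1 z≡p∸1
    pairs = units-pairing 1 (unit? ∖? (p ∸ 1) ∖? 1) (proj₁ ∘ proj₁) closed
    e = proj₁ pairs
    ∏≈1ᵉ = proj₂ (proj₂ pairs)

  non-residue⇒-1∈⟨x⟩ : 2 < p → ∀ {x} → ¬ (p ∣ x) → ¬ QRes x p →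
                       ∃[ e ] e ℕ.+ e ≤ p × (+ x) ^ e ≈ -1ℤ
  non-residue⇒-1∈⟨x⟩ 2<p {x} p∤x non-residue =
    let e , e+e≡size , ∏≈xᵉ = units-pairing x unit? (λ z-unit → z-unit) closed
    in e , subst (_≤ p) (sym e+e≡size) (size-≤ unit? p) , ≈-trans (≈-sym ∏≈xᵉ) (wilson 2<p)
    where
    closed : ∀ {z w} → Unit z → w < p → + z * + w ≈ + x → Unit w × w ≢ z
    closed {z} {w} (_ , z<p) w<p zw≈x = solution-unit {z} p∤x w<p zw≈x , w≢z
      where
      w≢z : w ≢ z
      w≢z refl = non-residue (lose (∈-upTo⁺ z<p) (≈⇒≡[mod] (≈-trans (≈-reflexive (ℤ.pos-* z z)) zw≈x)))

-- Cosets containing −1 are balanced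

2r<r+s⇔r<s : ∀ r s → 2 ℕ.* r < r ℕ.+ s ⇔ r < s
2r<r+s⇔r<s r s = mk⇔
  (λ 2r<r+s → subst (_< s) (ℕ.+-identityʳ r) (ℕ.+-cancelˡ-< r (r ℕ.+ 0) s 2r<r+s))
  (λ r<s → ℕ.+-monoʳ-< r (subst (_< s) (sym (ℕ.+-identityʳ r)) r<s))

r+s<2s⇔r<s : ∀ r s → r ℕ.+ s < 2 ℕ.* s ⇔ r < s
r+s<2s⇔r<s r s = mk⇔
  (λ r+s<2s → ℕ.+-cancelʳ-< s r s (subst (r ℕ.+ s <_) (cong (s ℕ.+_) (ℕ.+-identityʳ s)) r+s<2s))
  (λ r<s → subst (r ℕ.+ s <_) (cong (s ℕ.+_) (sym (ℕ.+-identityʳ s))) (ℕ.+-monoˡ-< s r<s))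

2r<m⇔m<2s : ∀ r s {m} → r ℕ.+ s ≡ m → 2 ℕ.* r < m ⇔ m < 2 ℕ.* s
2r<m⇔m<2s r s refl = ⇔-sym (r+s<2s⇔r<s r s) ⇔-∘ 2r<r+s⇔r<s r s

module NegationInCoset {m x e : ℕ} (2e≤m : e ℕ.+ e ≤ m) (xᵉ≈-1 : IntegerCongruence._≈_ m ((+ x) ^ e) -1ℤ) where

  open IntegerCongruence m
  open ≈-Reasoning ≈-setoid

  *xᵉ≈- : ∀ u → u * (+ x) ^ e ≈ - u
  *xᵉ≈- u = ≈-trans (*-cong (≈-refl {u}) xᵉ≈-1) (≈-reflexive (trans (ℤ.*-comm u -1ℤ) (ℤ.-1*i≡-i u)))

  *x^[j+e] : ∀ u j → u * (+ x) ^ (j ℕ.+ e) ≡ u * (+ x) ^ j * (+ x) ^ e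
  *x^[j+e] u j = trans (cong (u *_) (ℤ.^-distribˡ-+-* (+ x) j e)) (sym (ℤ.*-assoc u _ _))

  -- InCoset only admits exponents below m; e + e ≤ m keeps k + e (for k < e) there.
  negated-power : ∀ u {k} → k < m → ∃[ k′ ] k′ < m × u * (+ x) ^ k′ ≈ - (u * (+ x) ^ k)
  negated-power u {k} k<m with k <? e
  ... | yes k<e = k ℕ.+ e , ℕ.<-≤-trans (ℕ.+-monoˡ-< e k<e) 2e≤m , (begin
    u * (+ x) ^ (k ℕ.+ e)       ≡⟨ *x^[j+e] u k ⟩
    u * (+ x) ^ k * (+ x) ^ e   ≈⟨ *xᵉ≈- (u * (+ x) ^ k) ⟩
    - (u * (+ x) ^ k)           ∎)
  ... | no k≮e = k ∸ e , ℕ.≤-<-trans (ℕ.m∸n≤m k e) k<m , (begin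
    u * (+ x) ^ (k ∸ e)                   ≡⟨ ℤ.neg-involutive _ ⟨
    - - (u * (+ x) ^ (k ∸ e))             ≈⟨ -‿cong (*xᵉ≈- _) ⟨
    - (u * (+ x) ^ (k ∸ e) * (+ x) ^ e)   ≡⟨ cong -_ (*x^[j+e] u (k ∸ e)) ⟨
    - (u * (+ x) ^ (k ∸ e ℕ.+ e))         ≡⟨ cong (λ j → - (u * (+ x) ^ j)) (ℕ.m∸n+n≡m (ℕ.≮⇒≥ k≮e)) ⟩
    - (u * (+ x) ^ k)                     ∎)

  coset-closed : ∀ {a r s} → r ℕ.+ s ≡ m → InCoset x m a r → InCoset x m a s
  coset-closed {a} {r} {s} r+s≡m r∈a⟨x⟩ with find r∈a⟨x⟩
  ... | k , k∈upTo , axᵏ≡r with negated-power (+ a) (∈-upTo⁻ k∈upTo)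
  ...   | k′ , k′<m , axᵏ′≈-axᵏ = lose (∈-upTo⁺ k′<m) (≈⇒≡[mod] (begin
    + (a ℕ.* x ℕ.^ k′)     ≡⟨ pos-*^ k′ ⟩
    + a * (+ x) ^ k′       ≈⟨ axᵏ′≈-axᵏ ⟩
    - (+ a * (+ x) ^ k)    ≡⟨ cong -_ (pos-*^ k) ⟨
    - + (a ℕ.* x ℕ.^ k)    ≈⟨ -‿cong (≡[mod]⇒≈ axᵏ≡r) ⟩
    - + r                  ≈⟨ complement≈- r+s≡m ⟨
    + s                    ∎))
    where
    pos-*^ : ∀ k → + (a ℕ.* x ℕ.^ k) ≡ + a * (+ x) ^ k
    pos-*^ k = trans (ℤ.pos-* a (x ℕ.^ k)) (cong (+ a *_) (pos-^ x k))

-1∈⟨x⟩⇒balanced : ∀ {x m} → (∃[ e ] e ℕ.+ e ≤ m × IntegerCongruence._≈_ m ((+ x) ^ e) -1ℤ) →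
                  Balanced x m
-1∈⟨x⟩⇒balanced {x} {m} (e , 2e≤m , xᵉ≈-1) a _ =
  count-reflection _ _ (λ { (() , _) }) (λ { (() , _) }) lower⇔upper
  where
  open NegationInCoset {m} {x} {e} 2e≤m xᵉ≈-1
  Lower Upper : ℕ → Set
  Lower r = 0 < r × (2 ℕ.* r < m × InCoset x m a r)
  Upper s = m < 2 ℕ.* s × InCoset x m a s
  lower⇔upper : ∀ {r s} → r ℕ.+ s ≡ m → 0 < r → 0 < s → Lower r ⇔ Upper s
  lower⇔upper {r} {s} r+s≡m 0<r _ = mk⇔
    (λ (_ , 2r<m , r∈a⟨x⟩) → to 2r<m , coset-closed {a} r+s≡m r∈a⟨x⟩)
    (λ (m<2s , s∈a⟨x⟩) → 0<r , from m<2s , coset-closed {a} (trans (ℕ.+-comm s r) r+s≡m) s∈a⟨x⟩)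
    where open Equivalence (2r<m⇔m<2s r s r+s≡m)

legendre≡-1⇒non-residue : ∀ {x p} → legendre x p ≡ -[1+ 0 ] → ¬ (p ∣ x) × ¬ QRes x p
legendre≡-1⇒non-residue {x} {p} eq with p ∣? x
... | yes _ = contradiction eq λ ()
... | no p∤x with qres? x p
...   | yes _ = contradiction eq λ ()
...   | no ¬qr = p∤x , ¬qr

odd-prime⇒2<p : ∀ {p} → Prime p → ¬ (2 ∣ p) → 2 < p
odd-prime⇒2<p {0}                 p-prime _   = contradiction p-prime ¬prime[0]
odd-prime⇒2<p {1}                 p-prime _   = contradiction p-prime ¬prime[1]
odd-prime⇒2<p {2}                 _       2∤2 = contradiction ∣-refl 2∤2
odd-prime⇒2<p {suc (suc (suc _))} _       _   = s≤s (s≤s (s≤s z≤n))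

lemma4p6 : (x y : ℕ) → Prime x → Prime y → ¬ (2 ∣ x) → ¬ (2 ∣ y) → x ≢ y →
    legendre x y ≡ -[1+ 0 ] → Balanced x y
lemma4p6 x y _ y-prime _ 2∤y _ legendre≡-1 =
  -1∈⟨x⟩⇒balanced (non-residue⇒-1∈⟨x⟩ (odd-prime⇒2<p y-prime 2∤y) y∤x non-residue)
  where
  open PrimeModulus y-prime
  y∤x = proj₁ (legendre≡-1⇒non-residue legendre≡-1)
  non-residue = proj₂ (legendre≡-1⇒non-residue legendre≡-1)
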